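{- Let $\mathfrak{M}=(\mathbf{M},\models,\mathcal{P}(\mathscr{L}))$ be a normal abstract model structure such that $\mathscr{L}$ is not finitely satisfiable, and let $\vdash_{\mathfrak{M}}$ be its induced relation. The following are equivalent: (1) $\mathfrak{M}$ is compact. (2) Every finitely satisfiable set is contained in a $\vdash_{\mathfrak{M}}$-nontrivial maximal finitely satisfiable set. (3) Every finitely satisfiable set is contained in a maximal satisfiable set. (4) Every finitely satisfiable set is contained in a complete set. (5) Every $\vdash_{\mathfrak{M}}$-trivial set has a finite $\vdash_{\mathfrak{M}}$-trivial subset. (6) For every nonempty set $I$ and every $f:I\to\mathcal{P}(\mathscr{L})$ such that $(f(I),\subseteq)$ is directed (for all $i,j\in I$ there is $k\in I$ with $f(i)\cup f(j)\subseteq f(k)$): if $f(i)$ is satisfiable for all $i\in I$, then $\bigcup_{i\in I}f(i)$ is satisfiable. (7) For every $\Sigma\subseteq\mathscr{L}$ and every map $f:\mathsf{FinSet}(\Sigma)\to\mathcal{P}(\mathscr{L})$ that is order-preserving with respect to $\subseteq$ on both sides: if $f(\Gamma)$ is satisfiable for all $\Gamma\in\mathsf{FinSet}(\Sigma)$, then $\bigcup_{\Gamma\in\mathsf{FinSet}(\Sigma)}f(\Gamma)$ is satisfiable. (8) For every nonempty set $I$ and every $f:I\to\mathcal{P}(\mathbf{M})$ such that $(f(I),\supseteq)$ is directed (for all $i,j\in I$ there is $k\in I$ with $f(k)\subseteq f(i)\cap f(j)$): if $f(i)\neq\emptyset$ for all $i\in I$, then $\bigcup_{i\in I}\mathsf{Th}(f(i))$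 is satisfiable. (9) For every finitely satisfiable $\Sigma\subseteq\mathscr{L}$ and every map $f:\mathsf{FinSet}(\Sigma)\to\mathcal{P}(\mathbf{M})$ that is order-reversing with respect to $\subseteq$ (i.e. $\Gamma\subseteq\Gamma'$ implies $f(\Gamma')\subseteq f(\Gamma)$): if $f(\Gamma)\neq\emptyset$ for all $\Gamma\in\mathsf{FinSet}(\Sigma)$, then $\bigcup_{\Gamma\in\mathsf{FinSet}(\Sigma)}\mathsf{Th}(f(\Gamma))$ is satisfiable.
   Context: An abstract model structure is a triple $(\mathbf{M},\models,\mathcal{P}(\mathscr{L}))$ with $\mathbf{M}\neq\emptyset$, $\mathscr{L}$ a set and $\models\,\subseteq\mathbf{M}\times\mathcal{P}(\mathscr{L})$. It is normal if for all $m$ and $\Gamma$: $m\models\Gamma$ iff $m\models\{\alpha\}$ for all $\alpha\in\Gamma$. $\mathsf{Mod}(\Gamma)=\{m\in\mathbf{M}\mid m\models\Gamma\}$; $\mathsf{Th}(X)=\{\alpha\in\mathscr{L}\mid m\models\{\alpha\}\text{ for all }m\in X\}$ for $X\subseteq\mathbf{M}$. $\Gamma$ is satisfiable if $\mathsf{Mod}(\Gamma)\neq\emptyset$; finitely satisfiable if every finite subset is satisfiable; maximal (finitely) satisfiable if (finitely) satisfiable and no proper superset in $\mathscr{L}$ is (finitely) satisfiable. $\mathfrak{M}$ is compact if every finitely satisfiable $\Gamma\subseteq\mathscr{L}$ is satisfiable (and conversely). $\Gamma$ is complete if $\mathsf{Mod}(\Gamma)\ne\emptyset$ and for every $\alpha\in\mathscr{L}$,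 either $\mathsf{Mod}(\Gamma)\subseteq\mathsf{Mod}(\{\alpha\})$ or $\mathsf{Mod}(\Gamma)\subseteq\mathbf{M}\setminus\mathsf{Mod}(\{\alpha\})$. $\Gamma\vdash_{\mathfrak{M}}\alpha$ iff $\mathsf{Mod}(\Gamma)\subseteq\mathsf{Mod}(\{\alpha\})$; $\Gamma$ is $\vdash_{\mathfrak{M}}$-trivial if $\Gamma\vdash_{\mathfrak{M}}\beta$ for all $\beta\in\mathscr{L}$, nontrivial otherwise. $\mathsf{FinSet}(A)$ is the set of finite subsets of $A$. -}

module Defs where

open import Level using (Level; 0ℓ) renaming (suc to lsuc)
open import Data.Product using (Σ; Σ-syntax; ∃; ∃-syntax; _×_; _,_; proj₁)
open import Data.Sum using (_⊎_)
open import Data.List using (List)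
open import Data.List.Relation.Unary.All using (All)
open import Data.List.Membership.Propositional using () renaming (_∈_ to _∈ₗ_)
open import Data.Unit using (⊤)
open import Relation.Nullary using (¬_)
open import Relation.Unary using (Pred; _∈_; _⊆_; ｛_｝; ∁)
open import Function.Bundles using (_⇔_)

1ℓ : Level
1ℓ = lsuc 0ℓ

IsChain : {A : Set} → Pred (Pred A 0ℓ) 1ℓ → Set₁
IsChain 𝒞 = ∀ C D → C ∈ 𝒞 → D ∈ 𝒞 → C ⊆ D ⊎ D ⊆ C

ZornsLemma : Set₂
ZornsLemma = (A : Set) (𝓕 : Pred (Pred A 0ℓ) 1ℓ) →
  (∀ (𝒞 : Pred (Pred A 0ℓ) 1ℓ) → 𝒞 ⊆ 𝓕 → IsChain 𝒞 →
     Σ[ U ∈ Pred A 0ℓ ] (U ∈ 𝓕 × (∀ C → C ∈ 𝒞 → C ⊆ U))) →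
  Σ[ Y ∈ Pred A 0ℓ ] (Y ∈ 𝓕 × (∀ Z → Z ∈ 𝓕 → Y ⊆ Z → Z ⊆ Y))

-- Finite subsets.  A finite subset of Σ is presented by a list of
-- elements of Σ enumerating it; ⟦ Γ ⟧ is the subset it denotes.

FinSet : {A : Set} → Pred A 0ℓ → Set
FinSet {A} Σ' = Σ[ xs ∈ List A ] All (_∈ Σ') xs

⟦_⟧ : {A : Set} {Σ' : Pred A 0ℓ} → FinSet Σ' → Pred A 0ℓ
⟦ xs , _ ⟧ a = a ∈ₗ xs

module AMS {M L : Set} (_⊨_ : M → Pred L 0ℓ → Set) where

  Normal : Set₁
  Normal = ∀ (m : M) (Γ : Pred L 0ℓ) →
    (m ⊨ Γ) ⇔ (∀ α → α ∈ Γ → m ⊨ ｛ α ｝)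

  Mod : Pred L 0ℓ → Pred M 0ℓ
  Mod Γ m = m ⊨ Γ

  Th : Pred M 0ℓ → Pred L 0ℓ
  Th X α = ∀ m → m ∈ X → m ⊨ ｛ α ｝

  -- Mod(Γ) ≠ ∅ (read as: inhabited)
  Satisfiable : Pred L 0ℓ → Set
  Satisfiable Γ = ∃[ m ] (m ∈ Mod Γ)

  FinitelySatisfiable : Pred L 0ℓ → Set
  FinitelySatisfiable Γ = ∀ (Δ : FinSet Γ) → Satisfiable ⟦ Δ ⟧

  MaximalSatisfiable : Pred L 0ℓ → Set₁
  MaximalSatisfiable Γ =
    Satisfiable Γ × (∀ Δ → Γ ⊆ Δ → Satisfiable Δ → Δ ⊆ Γ)

  MaximalFinitelySatisfiable : Pred L 0ℓ → Set₁
  MaximalFinitelySatisfiable Γ =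
    FinitelySatisfiable Γ × (∀ Δ → Γ ⊆ Δ → FinitelySatisfiable Δ → Δ ⊆ Γ)

  Compact : Set₁
  Compact = ∀ (Γ : Pred L 0ℓ) → FinitelySatisfiable Γ ⇔ Satisfiable Γ

  Complete : Pred L 0ℓ → Set
  Complete Γ = Satisfiable Γ ×
    (∀ α → Mod Γ ⊆ Mod ｛ α ｝ ⊎ Mod Γ ⊆ ∁ (Mod ｛ α ｝))

  _⊢_ : Pred L 0ℓ → L → Set
  Γ ⊢ α = Mod Γ ⊆ Mod ｛ α ｝

  Trivial : Pred L 0ℓ → Set
  Trivial Γ = ∀ β → Γ ⊢ β

  Nontrivial : Pred L 0ℓ → Set
  Nontrivial Γ = ¬ Trivial Γ

  ⋃ : {I : Set} {A : Set} → (I → Pred A 0ℓ) → Pred A 0ℓ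
  ⋃ {I} f a = ∃[ i ] (a ∈ f i)

  ⋃Fin : {Σ' : Pred L 0ℓ} {A : Set} → (FinSet Σ' → Pred A 0ℓ) → Pred A 0ℓ
  ⋃Fin {Σ'} f a = Σ[ Γ ∈ FinSet Σ' ] (a ∈ f Γ)

  C1 C2 C3 C4 C5 C6 C7 C8 C9 : Set₁
  C1 = Compact
  C2 = ∀ Γ → FinitelySatisfiable Γ →
         Σ[ Δ ∈ Pred L 0ℓ ] (Γ ⊆ Δ × Nontrivial Δ × MaximalFinitelySatisfiable Δ)
  C3 = ∀ Γ → FinitelySatisfiable Γ →
         Σ[ Δ ∈ Pred L 0ℓ ] (Γ ⊆ Δ × MaximalSatisfiable Δ)
  C4 = ∀ Γ → FinitelySatisfiable Γ →
         Σ[ Δ ∈ Pred L 0ℓ ] (Γ ⊆ Δ × Complete Δ)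
  C5 = ∀ Γ → Trivial Γ → Σ[ Δ ∈ FinSet Γ ] Trivial ⟦ Δ ⟧
  C6 = ∀ (I : Set) → I → ∀ (f : I → Pred L 0ℓ) →
         (∀ i j → ∃[ k ] (f i ⊆ f k × f j ⊆ f k)) →
         (∀ i → Satisfiable (f i)) → Satisfiable (⋃ f)
  C7 = ∀ (Σ' : Pred L 0ℓ) (f : FinSet Σ' → Pred L 0ℓ) →
         (∀ Γ Γ' → ⟦ Γ ⟧ ⊆ ⟦ Γ' ⟧ → f Γ ⊆ f Γ') →
         (∀ Γ → Satisfiable (f Γ)) → Satisfiable (⋃Fin f)
  C8 = ∀ (I : Set) → I → ∀ (f : I → Pred M 0ℓ) →
         (∀ i j → ∃[ k ] (f k ⊆ f i × f k ⊆ f j)) →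
         (∀ i → ∃[ m ] (m ∈ f i)) → Satisfiable (⋃ (λ i → Th (f i)))
  C9 = ∀ (Σ' : Pred L 0ℓ) → FinitelySatisfiable Σ' →
         ∀ (f : FinSet Σ' → Pred M 0ℓ) →
         (∀ Γ Γ' → ⟦ Γ ⟧ ⊆ ⟦ Γ' ⟧ → f Γ' ⊆ f Γ) →
         (∀ Γ → ∃[ m ] (m ∈ f Γ)) → Satisfiable (⋃Fin (λ Γ → Th (f Γ)))

{-# OPTIONS --safe #-}
module Submission where

-- Under normality, satisfiability is inherited by subsets, and since L is
-- not even finitely satisfiable, a set is trivial exactly when it is
-- unsatisfiable.  Each condition is then compactness in disguise:
-- (2)–(4) because, by Tukey's lemma (from Zorn), every finitely
-- satisfiable set extends to a maximal one, which under compactness is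
-- satisfiable, maximal satisfiable and complete; (5) is the contrapositive
-- of compactness; (6)–(9) because finite subsets form a directed family,
-- a finite part of a directed union lies in one member, and Th turns
-- downward directed families of nonempty classes into upward directed
-- families of satisfiable theories.

open import Defs
open import Level using (0ℓ; Lift; lift; lower)
open import Data.Product using (_×_; Σ-syntax; ∃-syntax; _,_; proj₁; proj₂)
open import Data.Sum using (_⊎_; inj₁; inj₂)
open import Data.Unit using (⊤)
open import Data.Empty using (⊥-elim)
open import Data.List using (List; []; _∷_; _++_)
open import Data.List.Relation.Unary.All as All using (All; []; _∷_)
open import Data.List.Relation.Unary.All.Properties using (++⁺)
open import Data.List.Relation.Unary.Any using (here)
open import Data.List.Membership.Propositional using () renaming (_∈_ to _∈ₗ_)
open import Data.List.Membership.Propositional.Properties using (∈-++⁺ˡ; ∈-++⁺ʳ)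
open import Relation.Nullary using (¬_; yes; no)
open import Relation.Nullary.Decidable using (True; toWitness; fromWitness; map′)
open import Relation.Unary using (Pred; _∈_; _⊆_; _⊇_; _∪_; ｛_｝; ∁)
open import Relation.Binary.PropositionalEquality using (refl)
open import Function using (_∘_)
open import Function.Bundles using (_⇔_; mk⇔; Equivalence)
open import Axiom.ExcludedMiddle using (ExcludedMiddle)
open import Axiom.DoubleNegationElimination using (em⇒dne)

lower-excluded-middle : ExcludedMiddle 1ℓ → ExcludedMiddle 0ℓ
lower-excluded-middle em = map′ lower lift em

Directed : {I B : Set} → (Pred B 0ℓ → Pred B 0ℓ → Set) → (I → Pred B 0ℓ) → Set
Directed _≤_ f = ∀ i j → ∃[ k ] (f i ≤ f k × f j ≤ f k)

module _ {A : Set} where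

  directed-⋃-All : {I : Set} {f : I → Pred A 0ℓ} → I → Directed _⊆_ f →
    (xs : List A) → All (λ a → ∃[ i ] (a ∈ f i)) xs → ∃[ k ] All (_∈ f k) xs
  directed-⋃-All i₀ directed [] [] = i₀ , []
  directed-⋃-All i₀ directed (x ∷ xs) ((i , x∈fi) ∷ xs∈⋃)
    with directed-⋃-All i₀ directed xs xs∈⋃
  ... | j , xs∈fj with directed i j
  ...   | k , fi⊆fk , fj⊆fk = k , (fi⊆fk x∈fi ∷ All.map fj⊆fk xs∈fj)

  singleton : {Σ' : Pred A 0ℓ} {a : A} → a ∈ Σ' → FinSet Σ'
  singleton a∈Σ' = (_ ∷ []) , (a∈Σ' ∷ [])

  _∪F_ : {Σ' : Pred A 0ℓ} → FinSet Σ' → FinSet Σ' → FinSet Σ'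
  (xs , xs⊆Σ') ∪F (ys , ys⊆Σ') = (xs ++ ys) , ++⁺ xs⊆Σ' ys⊆Σ'

  FinSet-directed : {Σ' : Pred A 0ℓ} {B : Set} {R : Pred B 0ℓ → Pred B 0ℓ → Set}
    (f : FinSet Σ' → Pred B 0ℓ) → (∀ Γ Γ' → ⟦ Γ ⟧ ⊆ ⟦ Γ' ⟧ → R (f Γ) (f Γ')) →
    Directed R f
  FinSet-directed f monotone Γ@(xs , _) Γ' =
    Γ ∪F Γ' , monotone Γ (Γ ∪F Γ') ∈-++⁺ˡ , monotone Γ' (Γ ∪F Γ') (∈-++⁺ʳ xs)

  Union : Pred (Pred A 0ℓ) 1ℓ → Pred A 1ℓ
  Union 𝒞 a = ∃[ C ] (C ∈ 𝒞 × a ∈ C)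

  -- The extra member Γ makes the statement cover the empty chain as well.
  chain-All : {𝒞 : Pred (Pred A 0ℓ) 1ℓ} {Γ : Pred A 0ℓ} → IsChain 𝒞 →
    (∀ {C} → C ∈ 𝒞 → Γ ⊆ C) → (xs : List A) → All (Γ ∪ Union 𝒞) xs →
    All (_∈ Γ) xs ⊎ ∃[ C ] (C ∈ 𝒞 × All (_∈ C) xs)
  chain-All chain Γ⊆ [] [] = inj₁ []
  chain-All {𝒞} {Γ} chain Γ⊆ (x ∷ xs) (x∈ ∷ xs∈) =
    cons x∈ (chain-All chain Γ⊆ xs xs∈)
    where
    cons : x ∈ Γ ∪ Union 𝒞 → All (_∈ Γ) xs ⊎ ∃[ C ] (C ∈ 𝒞 × All (_∈ C) xs) →
      All (_∈ Γ) (x ∷ xs) ⊎ ∃[ C ] (C ∈ 𝒞 × All (_∈ C) (x ∷ xs))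
    cons (inj₁ x∈Γ) (inj₁ xs⊆Γ) = inj₁ (x∈Γ ∷ xs⊆Γ)
    cons (inj₁ x∈Γ) (inj₂ (D , D∈ , xs⊆D)) = inj₂ (D , D∈ , (Γ⊆ D∈ x∈Γ ∷ xs⊆D))
    cons (inj₂ (C , C∈ , x∈C)) (inj₁ xs⊆Γ) =
      inj₂ (C , C∈ , (x∈C ∷ All.map (Γ⊆ C∈) xs⊆Γ))
    cons (inj₂ (C , C∈ , x∈C)) (inj₂ (D , D∈ , xs⊆D)) with chain C D C∈ D∈
    ... | inj₁ C⊆D = inj₂ (D , D∈ , (C⊆D x∈C ∷ xs⊆D))
    ... | inj₂ D⊆C = inj₂ (C , C∈ , (x∈C ∷ All.map D⊆C xs⊆D))

Finitely : {A : Set} → (List A → Set) → Pred A 0ℓ → Set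
Finitely P D = (Δ : FinSet D) → P (proj₁ Δ)

tukey : ExcludedMiddle 1ℓ → ZornsLemma → {A : Set} (P : List A → Set) →
  {Γ : Pred A 0ℓ} → Finitely P Γ →
  Σ[ Δ ∈ Pred A 0ℓ ]
    (Γ ⊆ Δ × Finitely P Δ × (∀ Δ' → Δ ⊆ Δ' → Finitely P Δ' → Δ' ⊆ Δ))
tukey em zorn {A} P {Γ} PΓ =
  let Δ , lift (Γ⊆Δ , PΔ) , maximal = zorn A Extensions chain-bound
  in Δ , Γ⊆Δ , PΔ ,
     λ Δ' Δ⊆Δ' PΔ' → maximal Δ' (lift ((λ a∈Γ → Δ⊆Δ' (Γ⊆Δ a∈Γ)) , PΔ')) Δ⊆Δ'
  where
  Extensions : Pred (Pred A 0ℓ) 1ℓ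
  Extensions D = Lift 1ℓ (Γ ⊆ D × Finitely P D)

  chain-bound : ∀ 𝒞 → 𝒞 ⊆ Extensions → IsChain 𝒞 →
    Σ[ U ∈ Pred A 0ℓ ] (U ∈ Extensions × (∀ C → C ∈ 𝒞 → C ⊆ U))
  chain-bound 𝒞 𝒞⊆ chain =
    U , lift ((λ a∈Γ → fromWitness (inj₁ a∈Γ)) , PU) ,
    λ C C∈ a∈C → fromWitness (inj₂ (C , C∈ , a∈C))
    where
    -- Γ ∪ Union 𝒞 is only a Set₁-valued predicate; excluded middle resizes it.
    U : Pred A 0ℓ
    U a = True (em {a ∈ Γ ∪ Union 𝒞})

    PU : Finitely P U
    PU (xs , xs⊆U)
      with chain-All chain (λ C∈ → proj₁ (lower (𝒞⊆ C∈))) xs (All.map toWitness xs⊆U)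
    ... | inj₁ xs⊆Γ = PΓ (xs , xs⊆Γ)
    ... | inj₂ (C , C∈ , xs⊆C) = proj₂ (lower (𝒞⊆ C∈)) (xs , xs⊆C)

module ModelStructure {M L : Set} (_⊨_ : M → Pred L 0ℓ → Set) where
  open AMS _⊨_

  ¬Satisfiable⇒Trivial : ∀ {Γ} → ¬ Satisfiable Γ → Trivial Γ
  ¬Satisfiable⇒Trivial ¬sat β {m} m⊨Γ = ⊥-elim (¬sat (m , m⊨Γ))

  Th-antitone : ∀ {X Y} → X ⊆ Y → Th Y ⊆ Th X
  Th-antitone X⊆Y α∈ThY m m∈X = α∈ThY m (X⊆Y m∈X)

  Th-directed : {I : Set} {f : I → Pred M 0ℓ} →
    Directed _⊇_ f → Directed _⊆_ (λ i → Th (f i))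
  Th-directed directed i j =
    let k , fk⊆fi , fk⊆fj = directed i j
    in k , Th-antitone fk⊆fi , Th-antitone fk⊆fj

  maximal-finitely-satisfiable-extension : ExcludedMiddle 1ℓ → ZornsLemma →
    ∀ {Γ} → FinitelySatisfiable Γ →
    Σ[ Δ ∈ Pred L 0ℓ ] (Γ ⊆ Δ × MaximalFinitelySatisfiable Δ)
  maximal-finitely-satisfiable-extension em zorn =
    tukey em zorn (λ xs → Satisfiable (_∈ₗ xs))

  module Classical (em : ExcludedMiddle 0ℓ) where

    Nontrivial⇒Satisfiable : ∀ {Γ} → Nontrivial Γ → Satisfiable Γ
    Nontrivial⇒Satisfiable nt = em⇒dne em λ ¬sat → nt (¬Satisfiable⇒Trivial ¬sat)

    ¬FinitelySatisfiable⇒finite-unsatisfiable : ∀ {Γ} → ¬ FinitelySatisfiable Γ →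
      Σ[ Δ ∈ FinSet Γ ] ¬ Satisfiable ⟦ Δ ⟧
    ¬FinitelySatisfiable⇒finite-unsatisfiable ¬fs = em⇒dne em λ ¬unsat →
      ¬fs λ Δ → em⇒dne em λ ¬sat → ¬unsat (Δ , ¬sat)

  module Normality (normal : Normal) where

    ⊨-intro : ∀ {m Γ} → (∀ α → α ∈ Γ → m ⊨ ｛ α ｝) → m ⊨ Γ
    ⊨-intro {m} {Γ} = Equivalence.from (normal m Γ)

    ⊨-elim : ∀ {m Γ α} → m ⊨ Γ → α ∈ Γ → m ⊨ ｛ α ｝
    ⊨-elim {m} {Γ} {α} m⊨Γ = Equivalence.to (normal m Γ) m⊨Γ α

    Mod-antitone : ∀ {Γ Δ} → Γ ⊆ Δ → Mod Δ ⊆ Mod Γ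
    Mod-antitone Γ⊆Δ m⊨Δ = ⊨-intro λ α α∈Γ → ⊨-elim m⊨Δ (Γ⊆Δ α∈Γ)

    Satisfiable-antitone : ∀ {Γ Δ} → Γ ⊆ Δ → Satisfiable Δ → Satisfiable Γ
    Satisfiable-antitone Γ⊆Δ (m , m⊨Δ) = m , Mod-antitone Γ⊆Δ m⊨Δ

    Satisfiable⇒FinitelySatisfiable : ∀ {Γ} → Satisfiable Γ → FinitelySatisfiable Γ
    Satisfiable⇒FinitelySatisfiable sat (_ , Δ⊆Γ) =
      Satisfiable-antitone (All.lookup Δ⊆Γ) sat

    compact-intro : (∀ Γ → FinitelySatisfiable Γ → Satisfiable Γ) → Compact
    compact-intro fs⇒sat Γ = mk⇔ (fs⇒sat Γ) Satisfiable⇒FinitelySatisfiable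

    ⊆-Th-Mod : ∀ {Γ} → Γ ⊆ Th (Mod Γ)
    ⊆-Th-Mod α∈Γ m m⊨Γ = ⊨-elim m⊨Γ α∈Γ

    Th-satisfiable : ∀ {X} → ∃[ m ] (m ∈ X) → Satisfiable (Th X)
    Th-satisfiable (m , m∈X) = m , ⊨-intro λ α α∈ThX → α∈ThX m m∈X

    directed-⋃-finitely-satisfiable : {I : Set} {f : I → Pred L 0ℓ} →
      I → Directed _⊆_ f → (∀ i → Satisfiable (f i)) → FinitelySatisfiable (⋃ f)
    directed-⋃-finitely-satisfiable i₀ directed sat (xs , xs⊆⋃) =
      let k , xs⊆fk = directed-⋃-All i₀ directed xs xs⊆⋃
      in Satisfiable-antitone (All.lookup xs⊆fk) (sat k)

    Trivial⇒¬Satisfiable : ¬ FinitelySatisfiable (λ _ → ⊤) →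
      ∀ {Γ} → Trivial Γ → ¬ Satisfiable Γ
    Trivial⇒¬Satisfiable ¬fsL trivial (m , m⊨Γ) =
      ¬fsL (Satisfiable⇒FinitelySatisfiable (m , ⊨-intro λ β _ → trivial β m⊨Γ))

    MaximalSatisfiable⇒Complete : ExcludedMiddle 0ℓ →
      ∀ {Δ} → MaximalSatisfiable Δ → Complete Δ
    MaximalSatisfiable⇒Complete em {Δ} (sat , maximal) = sat , decide
      where
      decide : ∀ α → Mod Δ ⊆ Mod ｛ α ｝ ⊎ Mod Δ ⊆ ∁ (Mod ｛ α ｝)
      decide α with em {Satisfiable (Δ ∪ ｛ α ｝)}
      ... | yes sat′ = inj₁ λ m⊨Δ → ⊨-elim m⊨Δ (maximal _ inj₁ sat′ (inj₂ refl))
      ... | no ¬sat′ = inj₂ λ {m} m⊨Δ m⊨α → ¬sat′ (m , ⊨-intro λ where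
        β (inj₁ β∈Δ) → ⊨-elim m⊨Δ β∈Δ
        β (inj₂ refl) → m⊨α)

  module Equivalences (em : ExcludedMiddle 1ℓ) (zorn : ZornsLemma) (normal : Normal)
                      (¬fsL : ¬ FinitelySatisfiable (λ _ → ⊤)) where
    open Classical (lower-excluded-middle em)
    open Normality normal

    C1⇒C2 : C1 → C2
    C1⇒C2 compact Γ fs =
      let Δ , Γ⊆Δ , maxfs@(fsΔ , _) = maximal-finitely-satisfiable-extension em zorn fs
      in Δ , Γ⊆Δ ,
         (λ trivial → Trivial⇒¬Satisfiable ¬fsL trivial (Equivalence.to (compact Δ) fsΔ)) ,
         maxfs

    C2⇒C1 : C2 → C1
    C2⇒C1 c2 = compact-intro λ Γ fs →
      let Δ , Γ⊆Δ , nt , _ = c2 Γ fs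
      in Satisfiable-antitone Γ⊆Δ (Nontrivial⇒Satisfiable nt)

    C1⇒C3 : C1 → C3
    C1⇒C3 compact Γ fs =
      let Δ , Γ⊆Δ , fsΔ , maximal = maximal-finitely-satisfiable-extension em zorn fs
      in Δ , Γ⊆Δ , Equivalence.to (compact Δ) fsΔ ,
         λ Δ' Δ⊆Δ' sat → maximal Δ' Δ⊆Δ' (Satisfiable⇒FinitelySatisfiable sat)

    C3⇒C1 : C3 → C1
    C3⇒C1 c3 = compact-intro λ Γ fs →
      let Δ , Γ⊆Δ , sat , _ = c3 Γ fs in Satisfiable-antitone Γ⊆Δ sat

    C1⇒C4 : C1 → C4
    C1⇒C4 compact Γ fs =
      let Δ , Γ⊆Δ , maxsat = C1⇒C3 compact Γ fs
      in Δ , Γ⊆Δ , MaximalSatisfiable⇒Complete (lower-excluded-middle em) maxsat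

    C4⇒C1 : C4 → C1
    C4⇒C1 c4 = compact-intro λ Γ fs →
      let Δ , Γ⊆Δ , sat , _ = c4 Γ fs in Satisfiable-antitone Γ⊆Δ sat

    C1⇒C5 : C1 → C5
    C1⇒C5 compact Γ trivial =
      let ¬fs = λ fs → Trivial⇒¬Satisfiable ¬fsL trivial (Equivalence.to (compact Γ) fs)
          Δ , ¬sat = ¬FinitelySatisfiable⇒finite-unsatisfiable ¬fs
      in Δ , ¬Satisfiable⇒Trivial ¬sat

    C5⇒C1 : C5 → C1
    C5⇒C1 c5 = compact-intro λ Γ fs → Nontrivial⇒Satisfiable λ trivial →
      let Δ , trivialΔ = c5 Γ trivial in Trivial⇒¬Satisfiable ¬fsL trivialΔ (fs Δ)

    C1⇒C6 : C1 → C6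
    C1⇒C6 compact I i₀ f directed sat =
      Equivalence.to (compact (⋃ f)) (directed-⋃-finitely-satisfiable i₀ directed sat)

    C6⇒C7 : C6 → C7
    C6⇒C7 c6 Σ' f monotone =
      c6 (FinSet Σ') ([] , []) f (FinSet-directed {R = _⊆_} f monotone)

    C7⇒C1 : C7 → C1
    C7⇒C1 c7 = compact-intro λ Γ fs →
      Satisfiable-antitone (λ a∈Γ → singleton a∈Γ , here refl)
        (c7 Γ ⟦_⟧ (λ _ _ Δ⊆Δ' → Δ⊆Δ') fs)

    C6⇒C8 : C6 → C8
    C6⇒C8 c6 I i₀ f directed inhabited =
      c6 I i₀ (λ i → Th (f i)) (Th-directed directed) (λ i → Th-satisfiable (inhabited i))

    C8⇒C9 : C8 → C9
    C8⇒C9 c8 Σ' _ f antitone =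
      c8 (FinSet Σ') ([] , []) f (FinSet-directed {R = _⊇_} f antitone)

    C9⇒C1 : C9 → C1
    C9⇒C1 c9 = compact-intro λ Γ fs →
      Satisfiable-antitone (λ a∈Γ → singleton a∈Γ , ⊆-Th-Mod (here refl))
        (c9 Γ fs (λ Δ → Mod ⟦ Δ ⟧) (λ _ _ → Mod-antitone) fs)

theorem3p14 : ExcludedMiddle 1ℓ → ZornsLemma →
    (M L : Set) (_⊨_ : M → Pred L 0ℓ → Set) →
    let open AMS _⊨_ in
    Normal → ¬ FinitelySatisfiable (λ _ → ⊤) →
    (C1 ⇔ C2) × (C1 ⇔ C3) × (C1 ⇔ C4) × (C1 ⇔ C5) ×
    (C1 ⇔ C6) × (C1 ⇔ C7) × (C1 ⇔ C8) × (C1 ⇔ C9)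
theorem3p14 em zorn M L _⊨_ normal ¬fsL =
  mk⇔ C1⇒C2 C2⇒C1 , mk⇔ C1⇒C3 C3⇒C1 , mk⇔ C1⇒C4 C4⇒C1 , mk⇔ C1⇒C5 C5⇒C1 ,
  mk⇔ C1⇒C6 (C7⇒C1 ∘ C6⇒C7) ,
  mk⇔ (C6⇒C7 ∘ C1⇒C6) C7⇒C1 ,
  mk⇔ (C6⇒C8 ∘ C1⇒C6) (C9⇒C1 ∘ C8⇒C9) ,
  mk⇔ (C8⇒C9 ∘ C6⇒C8 ∘ C1⇒C6) C9⇒C1
  where open ModelStructure.Equivalences _⊨_ em zorn normal ¬fsL
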